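{- Let $k\ge 1$ and let $B_{k+1}$ be a generalized Bethe tree with $k+1$ levels, with $n$ vertices, in which the root (level $1$) has degree $d_1$ and every vertex on level $i$ has degree $d_i+1$ for $1<i\le k$ (so every vertex on level $i$, $1\le i\le k$, has exactly $d_i$ children, and the vertices on level $k+1$ are pendent). Then $$W(B_{k+1})=\sum_{i=1}^{k} n_{i+1}\, m_i\,(n-m_i),$$ where $n_{i+1}=d_1d_2\cdots d_i$ and $m_i=1+\sum_{j=i+1}^{k}\prod_{r=i+1}^{j} d_r$ for $1\le i\le k$ (so $m_k=1$).
   Context: For a connected graph $G$, $d(u,v)$ denotes the distance (number of edges of a shortest path) between $u$ and $v$, and the Wiener index is $W(G)=\sum_{\{u,v\}\subseteq V(G)} d(u,v)$, the sum over unordered pairs of distinct vertices. A generalized Bethe tree is a rooted tree in which all vertices at the same level have equal degrees; the root is at level $1$, its children at level $2$, and so on; a tree with $k+1$ levels has its deepest vertices at level $k+1$. -}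

module Defs where

open import Data.Nat using (ℕ; zero; suc; _+_; _*_; _∸_; _≤_)
open import Data.Fin using (Fin)
open import Data.List using (List; []; _∷_; map; upTo; concatMap; allFin; length)
open import Data.Nat.ListAction using (sum; product)
open import Data.Product using (_×_)

-- Generalized Bethe tree given by the list of child counts
-- [d₁, d₂, …, d_k] : the root has d₁ children, every vertex on level i
-- (1 ≤ i ≤ k) has dᵢ children, vertices on level k+1 are leaves.

data Vert : List ℕ → Set where
  root  : ∀ {ds} → Vert ds
  child : ∀ {d ds} → Fin d → Vert ds → Vert (d ∷ ds)

data Adj : ∀ {ds} → Vert ds → Vert ds → Set where
  down   : ∀ {d ds} (i : Fin d) → Adj {d ∷ ds} root (child i root)
  up     : ∀ {d ds} (i : Fin d) → Adj {d ∷ ds} (child i root) root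
  inside : ∀ {d ds} (i : Fin d) {u v : Vert ds} → Adj u v → Adj (child i u) (child i v)

allVerts : (ds : List ℕ) → List (Vert ds)
allVerts []       = root ∷ []
allVerts (d ∷ ds) = root ∷ concatMap (λ i → map (child i) (allVerts ds)) (allFin d)

data Walk {ds : List ℕ} : Vert ds → Vert ds → ℕ → Set where
  here : ∀ {u} → Walk u u 0
  step : ∀ {u v w m} → Adj u v → Walk v w m → Walk u w (suc m)

IsDistance : (ds : List ℕ) → (Vert ds → Vert ds → ℕ) → Set
IsDistance ds δ = ∀ u v → Walk u v (δ u v) × (∀ m → Walk u v m → δ u v ≤ m)

pairSum : ∀ {A : Set} → (A → A → ℕ) → List A → ℕ
pairSum f []       = 0
pairSum f (x ∷ xs) = sum (map (f x) xs) + pairSum f xs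

wiener : (ds : List ℕ) → (Vert ds → Vert ds → ℕ) → ℕ
wiener ds δ = pairSum δ (allVerts ds)

-- [a, a+1, …, b]  (empty if b < a)
range : ℕ → ℕ → List ℕ
range a b = map (a +_) (upTo (suc b ∸ a))

prodR : (ℕ → ℕ) → ℕ → ℕ → ℕ
prodR d a b = product (map d (range a b))

sumR : (ℕ → ℕ) → ℕ → ℕ → ℕ
sumR f a b = sum (map f (range a b))

betheList : (ℕ → ℕ) → ℕ → List ℕ
betheList d k = map d (range 1 k)

nVerts : (ℕ → ℕ) → ℕ → ℕ
nVerts d k = length (allVerts (betheList d k))

-- n_{i+1} = d₁ d₂ ⋯ dᵢ
nLevel : (ℕ → ℕ) → ℕ → ℕ
nLevel d i = prodR d 1 i

mSize : (ℕ → ℕ) → ℕ → ℕ → ℕ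
mSize d k i = 1 + sumR (λ j → prodR d (suc i) j) (suc i) k

-- The distance between two vertices of a tree is the number of edges on the
-- path joining them, so the Wiener index is the sum over edges e of the number
-- of pairs separated by e.  In B_{k+1} there are n_{i+1} edges between levels
-- i and i+1, and each cuts off a subtree with m_i vertices from the other
-- n - m_i.  The proof runs this count by recursion on the root: with
-- N, D and W the order, total depth and Wiener index of the tree below a child
-- of the root, the tree with d root children has total depth d (N + D) and
-- Wiener index d (N + D) + d W + d (d - 1) N (N + D).
module Submission where

open import Defs
open import Data.Nat using (ℕ; zero; suc; _+_; _*_; _∸_; _≤_; z≤n; s≤s)
open import Data.Nat.Properties
  using (≤-refl; ≤-trans; ≤-reflexive; ≤-antisym; m≤n+m; +-monoˡ-≤;
         +-identityʳ; +-assoc; *-identityʳ; *-zeroʳ; *-assoc; *-distribˡ-+; m+n∸m≡n)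
open import Data.Nat.ListAction using (sum; product)
open import Data.Nat.ListAction.Properties using (sum-++)
open import Data.Nat.Tactic.RingSolver using (solve-∀)
open import Data.Fin using (Fin)
open import Data.Fin.Properties using (_≟_)
open import Data.List using (List; []; _∷_; _++_; map; concat; allFin; length; upTo; applyUpTo)
open import Data.List.Properties
  using (map-++; map-∘; map-cong; map-cong-local; map-upTo; length-++; length-map; length-tabulate)
import Data.List.Relation.Unary.AllPairs as AllPairs
open AllPairs using (AllPairs; []; _∷_)
open import Data.List.Relation.Unary.Unique.Propositional.Properties using (allFin⁺)
open import Data.Product using (Σ; _×_; _,_; proj₁; proj₂)
open import Data.Empty using (⊥-elim)
open import Function using (_∘_)
open import Relation.Nullary using (yes; no)
open import Relation.Binary.PropositionalEquality
  using (_≡_; _≢_; refl; sym; trans; cong; cong₂; module ≡-Reasoning)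

open ≡-Reasoning

-- The graph distance of a Bethe tree

depth : ∀ {ds} → Vert ds → ℕ
depth root        = 0
depth (child i v) = suc (depth v)

dist : ∀ {ds} → Vert ds → Vert ds → ℕ
dist root        v           = depth v
dist (child i u) root        = suc (depth u)
dist (child i u) (child j v) with i ≟ j
... | yes _ = dist u v
... | no  _ = suc (depth u) + suc (depth v)

dist-child-≡ : ∀ {d ds} (i : Fin d) (u v : Vert ds) → dist (child i u) (child i v) ≡ dist u v
dist-child-≡ i u v with i ≟ i
... | yes _   = refl
... | no  i≢i = ⊥-elim (i≢i refl)

dist-child-≢ : ∀ {d ds} {i j : Fin d} → i ≢ j → (u v : Vert ds) →
               dist (child i u) (child j v) ≡ suc (depth u) + suc (depth v)
dist-child-≢ {i = i} {j} i≢j u v with i ≟ j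
... | yes i≡j = ⊥-elim (i≢j i≡j)
... | no  _   = refl

dist-self : ∀ {ds} (u : Vert ds) → dist u u ≡ 0
dist-self root        = refl
dist-self (child i u) = trans (dist-child-≡ i u u) (dist-self u)

depth-≤-adj : ∀ {ds} {u v : Vert ds} → Adj u v → depth u ≤ suc (depth v)
depth-≤-adj (down i)     = z≤n
depth-≤-adj (up i)       = s≤s z≤n
depth-≤-adj (inside i a) = s≤s (depth-≤-adj a)

dist-≤-adj : ∀ {ds} {u v : Vert ds} → Adj u v → ∀ w → dist u w ≤ suc (dist v w)
dist-≤-adj (down i)     root        = z≤n
dist-≤-adj (down i)     (child j w) with i ≟ j
... | yes _ = ≤-refl
... | no  _ = s≤s (m≤n+m _ 2)
dist-≤-adj (up i)       root        = ≤-refl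
dist-≤-adj (up i)       (child j w) with i ≟ j
... | yes _ = m≤n+m _ 2
... | no  _ = ≤-refl
dist-≤-adj (inside i a) root        = s≤s (depth-≤-adj a)
dist-≤-adj (inside i a) (child j w) with i ≟ j
... | yes _ = dist-≤-adj a w
... | no  _ = s≤s (+-monoˡ-≤ (suc (depth w)) (depth-≤-adj a))

dist-≤-walk : ∀ {ds} {u v : Vert ds} {m} → Walk u v m → dist u v ≤ m
dist-≤-walk {u = u} here   = ≤-reflexive (dist-self u)
dist-≤-walk (step {w = w} a p) = ≤-trans (dist-≤-adj a w) (s≤s (dist-≤-walk p))

module _ {ds : List ℕ} where

  infixr 5 _++ʷ_
  infixl 5 _∷ʳʷ_

  _++ʷ_ : ∀ {u v w : Vert ds} {m n} → Walk u v m → Walk v w n → Walk u w (m + n)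
  here     ++ʷ q = q
  step a p ++ʷ q = step a (p ++ʷ q)

  _∷ʳʷ_ : ∀ {u v w : Vert ds} {m} → Walk u v m → Adj v w → Walk u w (suc m)
  here     ∷ʳʷ b = step b here
  step a p ∷ʳʷ b = step a (p ∷ʳʷ b)

liftʷ : ∀ {d ds} (i : Fin d) {u v : Vert ds} {m} → Walk u v m → Walk (child i u) (child i v) m
liftʷ i here       = here
liftʷ i (step a p) = step (inside i a) (liftʷ i p)

fromRoot : ∀ {ds} (v : Vert ds) → Walk root v (depth v)
fromRoot root        = here
fromRoot (child i v) = step (down i) (liftʷ i (fromRoot v))

toRoot : ∀ {ds} (v : Vert ds) → Walk v root (depth v)
toRoot root        = here
toRoot (child i v) = liftʷ i (toRoot v) ∷ʳʷ up i

walk-dist : ∀ {ds} (u v : Vert ds) → Walk u v (dist u v)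
walk-dist root        v           = fromRoot v
walk-dist (child i u) root        = toRoot (child i u)
walk-dist (child i u) (child j v) with i ≟ j
... | yes refl = liftʷ i (walk-dist u v)
... | no  _    = toRoot (child i u) ++ʷ fromRoot (child j v)

dist-isDistance : ∀ ds → IsDistance ds dist
dist-isDistance ds u v = walk-dist u v , λ _ → dist-≤-walk

isDistance⇒≡dist : ∀ {ds δ} → IsDistance ds δ → ∀ u v → δ u v ≡ dist u v
isDistance⇒≡dist isδ u v =
  ≤-antisym (proj₂ (isδ u v) _ (walk-dist u v)) (dist-≤-walk (proj₁ (isδ u v)))

-- Sums over lists and over pairs

module _ {A : Set} where

  sum-map-+ : (f g : A → ℕ) (xs : List A) →
              sum (map (λ x → f x + g x) xs) ≡ sum (map f xs) + sum (map g xs)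
  sum-map-+ f g []       = refl
  sum-map-+ f g (x ∷ xs) = begin
    f x + g x + sum (map (λ x → f x + g x) xs)  ≡⟨ cong (f x + g x +_) (sum-map-+ f g xs) ⟩
    f x + g x + (sum (map f xs) + sum (map g xs)) ≡⟨ interchange (f x) (g x) _ _ ⟩
    f x + sum (map f xs) + (g x + sum (map g xs)) ∎
    where
    interchange : ∀ a b c e → a + b + (c + e) ≡ a + c + (b + e)
    interchange = solve-∀

  sum-map-const : (c : ℕ) (xs : List A) → sum (map (λ _ → c) xs) ≡ length xs * c
  sum-map-const c []       = refl
  sum-map-const c (x ∷ xs) = cong (c +_) (sum-map-const c xs)

  sum-map-*ˡ : (c : ℕ) (f : A → ℕ) (xs : List A) → sum (map (λ x → c * f x) xs) ≡ c * sum (map f xs)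
  sum-map-*ˡ c f []       = sym (*-zeroʳ c)
  sum-map-*ˡ c f (x ∷ xs) =
    trans (cong (c * f x +_) (sum-map-*ˡ c f xs)) (sym (*-distribˡ-+ c (f x) _))

  sum-map-concat : (f : A → ℕ) (xss : List (List A)) →
                   sum (map f (concat xss)) ≡ sum (map (sum ∘ map f) xss)
  sum-map-concat f []         = refl
  sum-map-concat f (xs ∷ xss) = begin
    sum (map f (xs ++ concat xss))              ≡⟨ cong sum (map-++ f xs (concat xss)) ⟩
    sum (map f xs ++ map f (concat xss))        ≡⟨ sum-++ (map f xs) _ ⟩
    sum (map f xs) + sum (map f (concat xss))   ≡⟨ cong (sum (map f xs) +_) (sum-map-concat f xss) ⟩
    sum (map f xs) + sum (map (sum ∘ map f) xss) ∎

  length-concat : (xss : List (List A)) → length (concat xss) ≡ sum (map length xss)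
  length-concat []         = refl
  length-concat (xs ∷ xss) = trans (length-++ xs) (cong (length xs +_) (length-concat xss))

  cross : (A → A → ℕ) → List A → List A → ℕ
  cross f as bs = sum (map (λ a → sum (map (f a) bs)) as)

  cross-cong : ∀ {f g : A → A → ℕ} → (∀ a b → f a b ≡ g a b) → ∀ as bs → cross f as bs ≡ cross g as bs
  cross-cong f≡g as bs = cong sum (map-cong (λ a → cong sum (map-cong (f≡g a) bs)) as)

  cross-+ : (g h : A → ℕ) (as bs : List A) →
            cross (λ a b → g a + h b) as bs ≡ length bs * sum (map g as) + length as * sum (map h bs)
  cross-+ g h []       bs = sym (trans (+-identityʳ (length bs * 0)) (*-zeroʳ (length bs)))
  cross-+ g h (a ∷ as) bs = begin
    sum (map (λ b → g a + h b) bs) + cross (λ a b → g a + h b) as bs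
      ≡⟨ cong₂ _+_ (sum-map-+ (λ _ → g a) h bs) (cross-+ g h as bs) ⟩
    sum (map (λ _ → g a) bs) + H + (length bs * G + length as * H)
      ≡⟨ cong (λ t → t + H + (length bs * G + length as * H)) (sum-map-const (g a) bs) ⟩
    length bs * g a + H + (length bs * G + length as * H)
      ≡⟨ regroup (length bs) (g a) G (length as) H ⟩
    length bs * (g a + G) + suc (length as) * H ∎
    where
    G = sum (map g as)
    H = sum (map h bs)
    regroup : ∀ l x G m H → l * x + H + (l * G + m * H) ≡ l * (x + G) + suc m * H
    regroup = solve-∀

  cross-++ʳ : (f : A → A → ℕ) (as bs cs : List A) → cross f as (bs ++ cs) ≡ cross f as bs + cross f as cs
  cross-++ʳ f as bs cs = begin
    cross f as (bs ++ cs)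
      ≡⟨ cong sum (map-cong (λ a → trans (cong sum (map-++ (f a) bs cs)) (sum-++ (map (f a) bs) _)) as) ⟩
    sum (map (λ a → sum (map (f a) bs) + sum (map (f a) cs)) as)
      ≡⟨ sum-map-+ _ _ as ⟩
    cross f as bs + cross f as cs ∎

  cross-concatʳ : (f : A → A → ℕ) (as : List A) (bss : List (List A)) →
                  cross f as (concat bss) ≡ sum (map (cross f as) bss)
  cross-concatʳ f as []         = trans (sum-map-const 0 as) (*-zeroʳ (length as))
  cross-concatʳ f as (bs ∷ bss) =
    trans (cross-++ʳ f as bs (concat bss)) (cong (cross f as bs +_) (cross-concatʳ f as bss))

  pairSum-cong : ∀ {f g : A → A → ℕ} → (∀ x y → f x y ≡ g x y) → ∀ xs → pairSum f xs ≡ pairSum g xs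
  pairSum-cong f≡g []       = refl
  pairSum-cong f≡g (x ∷ xs) = cong₂ _+_ (cong sum (map-cong (f≡g x) xs)) (pairSum-cong f≡g xs)

  pairSum-cong-AllPairs : ∀ {f g : A → A → ℕ} {xs} →
                          AllPairs (λ x y → f x y ≡ g x y) xs → pairSum f xs ≡ pairSum g xs
  pairSum-cong-AllPairs []          = refl
  pairSum-cong-AllPairs (fx≡gx ∷ p) = cong₂ _+_ (cong sum (map-cong-local fx≡gx)) (pairSum-cong-AllPairs p)

  -- The constant is written c + c so that no halving is needed: d (d - 1) c
  -- is the closed form of 2 c · (d choose 2).
  pairSum-const : (c : ℕ) (xs : List A) → pairSum (λ _ _ → c + c) xs ≡ length xs * (length xs ∸ 1) * c
  pairSum-const c []       = refl
  pairSum-const c (x ∷ xs) = begin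
    sum (map (λ _ → c + c) xs) + pairSum (λ _ _ → c + c) xs
      ≡⟨ cong₂ _+_ (sum-map-const (c + c) xs) (pairSum-const c xs) ⟩
    length xs * (c + c) + length xs * (length xs ∸ 1) * c
      ≡⟨ choose2-suc (length xs) ⟩
    suc (length xs) * length xs * c ∎
    where
    choose2-suc : ∀ l → l * (c + c) + l * (l ∸ 1) * c ≡ suc l * l * c
    choose2-suc zero    = refl
    choose2-suc (suc l) = identity l c
      where
      identity : ∀ l c → suc l * (c + c) + suc l * l * c ≡ suc (suc l) * suc l * c
      identity = solve-∀

  pairSum-++ : (f : A → A → ℕ) (as bs : List A) →
               pairSum f (as ++ bs) ≡ pairSum f as + pairSum f bs + cross f as bs
  pairSum-++ f []       bs = sym (+-identityʳ _)
  pairSum-++ f (a ∷ as) bs = begin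
    sum (map (f a) (as ++ bs)) + pairSum f (as ++ bs)
      ≡⟨ cong₂ _+_ (trans (cong sum (map-++ (f a) as bs)) (sum-++ (map (f a) as) _)) (pairSum-++ f as bs) ⟩
    sum (map (f a) as) + sum (map (f a) bs) + (pairSum f as + pairSum f bs + cross f as bs)
      ≡⟨ regroup (sum (map (f a) as)) (sum (map (f a) bs)) (pairSum f as) (pairSum f bs) (cross f as bs) ⟩
    sum (map (f a) as) + pairSum f as + pairSum f bs + (sum (map (f a) bs) + cross f as bs) ∎
    where
    regroup : ∀ a b c d e → a + b + (c + d + e) ≡ a + c + d + (b + e)
    regroup = solve-∀

  pairSum-concat : (f : A → A → ℕ) (xss : List (List A)) →
                   pairSum f (concat xss) ≡ sum (map (pairSum f) xss) + pairSum (cross f) xss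
  pairSum-concat f []         = refl
  pairSum-concat f (xs ∷ xss) = begin
    pairSum f (xs ++ concat xss)
      ≡⟨ pairSum-++ f xs (concat xss) ⟩
    pairSum f xs + pairSum f (concat xss) + cross f xs (concat xss)
      ≡⟨ cong₂ (λ s t → pairSum f xs + s + t) (pairSum-concat f xss) (cross-concatʳ f xs xss) ⟩
    pairSum f xs + (sum (map (pairSum f) xss) + pairSum (cross f) xss) + sum (map (cross f xs) xss)
      ≡⟨ regroup (pairSum f xs) _ _ _ ⟩
    pairSum f xs + sum (map (pairSum f) xss) + (sum (map (cross f xs) xss) + pairSum (cross f) xss) ∎
    where
    regroup : ∀ a b c e → a + (b + c) + e ≡ a + b + (e + c)
    regroup = solve-∀

module _ {A B : Set} where

  pairSum-map : (f : A → A → ℕ) (g : B → A) (xs : List B) →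
                pairSum f (map g xs) ≡ pairSum (λ x y → f (g x) (g y)) xs
  pairSum-map f g []       = refl
  pairSum-map f g (x ∷ xs) = cong₂ _+_ (cong sum (sym (map-∘ xs))) (pairSum-map f g xs)

  cross-map : (f : A → A → ℕ) (g h : B → A) (as bs : List B) →
              cross f (map g as) (map h bs) ≡ cross (λ a b → f (g a) (h b)) as bs
  cross-map f g h as bs =
    trans (cong sum (sym (map-∘ as))) (cong sum (map-cong (λ a → cong sum (sym (map-∘ bs))) as))

sum-allFin-const : ∀ d c → sum (map (λ _ → c) (allFin d)) ≡ d * c
sum-allFin-const d c = trans (sum-map-const c (allFin d)) (cong (_* c) (length-tabulate {n = d} (λ i → i)))

-- Order, total depth and Wiener index of a Bethe tree

order : List ℕ → ℕ
order ds = length (allVerts ds)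

totalDepth : List ℕ → ℕ
totalDepth ds = sum (map depth (allVerts ds))

treeWiener : List ℕ → ℕ
treeWiener ds = pairSum dist (allVerts ds)

module _ (d : ℕ) (ds : List ℕ) where
  private
    vs = allVerts ds
    n  = order ds
    D  = totalDepth ds

  subtree : Fin d → List (Vert (d ∷ ds))
  subtree i = map (child i) vs

  sum-suc-depth : sum (map (suc ∘ depth) vs) ≡ n + D
  sum-suc-depth = trans (sum-map-+ (λ _ → 1) depth vs) (cong (_+ D) (trans (sum-map-const 1 vs) (*-identityʳ n)))

  order-cons : order (d ∷ ds) ≡ suc (d * n)
  order-cons = cong suc (begin
    length (concat (map subtree (allFin d)))     ≡⟨ length-concat (map subtree (allFin d)) ⟩
    sum (map length (map subtree (allFin d)))    ≡⟨ cong sum (sym (map-∘ (allFin d))) ⟩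
    sum (map (length ∘ subtree) (allFin d))      ≡⟨ cong sum (map-cong (λ i → length-map (child i) vs) (allFin d)) ⟩
    sum (map (λ _ → n) (allFin d))               ≡⟨ sum-allFin-const d n ⟩
    d * n                                        ∎)

  totalDepth-cons : totalDepth (d ∷ ds) ≡ d * (n + D)
  totalDepth-cons = begin
    sum (map depth (concat (map subtree (allFin d))))      ≡⟨ sum-map-concat depth (map subtree (allFin d)) ⟩
    sum (map (sum ∘ map depth) (map subtree (allFin d)))   ≡⟨ cong sum (sym (map-∘ (allFin d))) ⟩
    sum (map (λ i → sum (map depth (subtree i))) (allFin d))
      ≡⟨ cong sum (map-cong (λ i → cong sum (sym (map-∘ vs))) (allFin d)) ⟩
    sum (map (λ _ → sum (map (suc ∘ depth) vs)) (allFin d)) ≡⟨ sum-allFin-const d _ ⟩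
    d * sum (map (suc ∘ depth) vs)                          ≡⟨ cong (d *_) sum-suc-depth ⟩
    d * (n + D)                                             ∎

  pairSum-subtree : ∀ i → pairSum dist (subtree i) ≡ treeWiener ds
  pairSum-subtree i = trans (pairSum-map dist (child i) vs) (pairSum-cong (dist-child-≡ i) vs)

  cross-subtree : ∀ {i j} → i ≢ j → cross dist (subtree i) (subtree j) ≡ n * (n + D) + n * (n + D)
  cross-subtree {i} {j} i≢j = begin
    cross dist (subtree i) (subtree j)                           ≡⟨ cross-map dist (child i) (child j) vs vs ⟩
    cross (λ u v → dist (child i u) (child j v)) vs vs          ≡⟨ cross-cong (dist-child-≢ i≢j) vs vs ⟩
    cross (λ u v → suc (depth u) + suc (depth v)) vs vs          ≡⟨ cross-+ (suc ∘ depth) (suc ∘ depth) vs vs ⟩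
    n * sum (map (suc ∘ depth) vs) + n * sum (map (suc ∘ depth) vs)
      ≡⟨ cong (λ s → n * s + n * s) sum-suc-depth ⟩
    n * (n + D) + n * (n + D)                                   ∎

  -- The root contributes the total depth; the remaining pairs lie in one
  -- subtree or in two different ones.
  treeWiener-cons : treeWiener (d ∷ ds) ≡ totalDepth (d ∷ ds) + d * treeWiener ds + d * (d ∸ 1) * (n * (n + D))
  treeWiener-cons = begin
    totalDepth (d ∷ ds) + pairSum dist (concat blocks)
      ≡⟨ cong (totalDepth (d ∷ ds) +_) (pairSum-concat dist blocks) ⟩
    totalDepth (d ∷ ds) + (sum (map (pairSum dist) blocks) + pairSum (cross dist) blocks)
      ≡⟨ cong (totalDepth (d ∷ ds) +_) (cong₂ _+_ within between) ⟩
    totalDepth (d ∷ ds) + (d * treeWiener ds + d * (d ∸ 1) * (n * (n + D)))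
      ≡⟨ sym (+-assoc (totalDepth (d ∷ ds)) _ _) ⟩
    totalDepth (d ∷ ds) + d * treeWiener ds + d * (d ∸ 1) * (n * (n + D)) ∎
    where
    blocks = map subtree (allFin d)

    within : sum (map (pairSum dist) blocks) ≡ d * treeWiener ds
    within = begin
      sum (map (pairSum dist) blocks)             ≡⟨ cong sum (sym (map-∘ (allFin d))) ⟩
      sum (map (pairSum dist ∘ subtree) (allFin d)) ≡⟨ cong sum (map-cong pairSum-subtree (allFin d)) ⟩
      sum (map (λ _ → treeWiener ds) (allFin d))   ≡⟨ sum-allFin-const d _ ⟩
      d * treeWiener ds                           ∎

    between : pairSum (cross dist) blocks ≡ d * (d ∸ 1) * (n * (n + D))
    between = begin
      pairSum (cross dist) blocks
        ≡⟨ pairSum-map (cross dist) subtree (allFin d) ⟩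
      pairSum (λ i j → cross dist (subtree i) (subtree j)) (allFin d)
        ≡⟨ pairSum-cong-AllPairs (AllPairs.map cross-subtree (allFin⁺ d)) ⟩
      pairSum (λ _ _ → n * (n + D) + n * (n + D)) (allFin d)
        ≡⟨ pairSum-const (n * (n + D)) (allFin d) ⟩
      length (allFin d) * (length (allFin d) ∸ 1) * (n * (n + D))
        ≡⟨ cong (λ l → l * (l ∸ 1) * (n * (n + D))) (length-tabulate {n = d} (λ i → i)) ⟩
      d * (d ∸ 1) * (n * (n + D)) ∎

-- cutSum ds X sums, over the edges of the tree, the size of the subtree cut
-- off below the edge times the number of the X vertices not in it.
cutSum : List ℕ → ℕ → ℕ
cutSum []       X = 0
cutSum (d ∷ ds) X = d * order ds * (X ∸ order ds) + d * cutSum ds X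

-- The X extra vertices may be thought of as sitting at the root; generalising
-- over them is what makes the induction go through.
cutSum-order-+ : ∀ ds X → cutSum ds (order ds + X) ≡ treeWiener ds + X * totalDepth ds
cutSum-order-+ []           X = sym (*-zeroʳ X)
cutSum-order-+ (zero  ∷ ds) X = sym (*-zeroʳ X)
cutSum-order-+ (suc e ∷ ds) X = begin
  cutSum (d ∷ ds) (order (d ∷ ds) + X)
    ≡⟨ cong (λ m → cutSum (d ∷ ds) (m + X)) (order-cons d ds) ⟩
  d * n * (suc (d * n) + X ∸ n) + d * cutSum ds (suc (d * n) + X)
    ≡⟨ cong (λ m → d * n * (m ∸ n) + d * cutSum ds m) (split e n X) ⟩
  d * n * (n + Y ∸ n) + d * cutSum ds (n + Y)
    ≡⟨ cong₂ (λ a b → d * n * a + d * b) (m+n∸m≡n n Y) (cutSum-order-+ ds Y) ⟩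
  d * n * Y + d * (W + Y * D)
    ≡⟨ expand e n D W X ⟩
  d * (n + D) + d * W + d * e * (n * (n + D)) + X * (d * (n + D))
    ≡⟨ cong (λ t → t + d * W + d * e * (n * (n + D)) + X * t) (sym (totalDepth-cons d ds)) ⟩
  totalDepth (d ∷ ds) + d * W + d * e * (n * (n + D)) + X * totalDepth (d ∷ ds)
    ≡⟨ cong (_+ X * totalDepth (d ∷ ds)) (sym (treeWiener-cons d ds)) ⟩
  treeWiener (d ∷ ds) + X * totalDepth (d ∷ ds) ∎
  where
  d = suc e
  n = order ds
  D = totalDepth ds
  W = treeWiener ds
  Y = suc (e * n) + X
  split : ∀ e n X → suc (suc e * n) + X ≡ n + (suc (e * n) + X)
  split = solve-∀
  expand : ∀ e n D W X → suc e * n * (suc (e * n) + X) + suc e * (W + (suc (e * n) + X) * D)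
                         ≡ suc e * (n + D) + suc e * W + suc e * e * (n * (n + D)) + X * (suc e * (n + D))
  expand = solve-∀

treeWiener≡cutSum : ∀ ds → treeWiener ds ≡ cutSum ds (order ds)
treeWiener≡cutSum ds = begin
  treeWiener ds                         ≡⟨ sym (+-identityʳ _) ⟩
  treeWiener ds + 0 * totalDepth ds     ≡⟨ sym (cutSum-order-+ ds 0) ⟩
  cutSum ds (order ds + 0)              ≡⟨ cong (cutSum ds) (+-identityʳ _) ⟩
  cutSum ds (order ds)                  ∎

-- Peeling off the first level of the index ranges

map-range-suc : ∀ {A : Set} (f : ℕ → A) a b → map f (range (suc a) (suc b)) ≡ map (f ∘ suc) (range a b)
map-range-suc f a b = trans (sym (map-∘ (upTo (suc b ∸ a)))) (map-∘ (upTo (suc b ∸ a)))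

map-range-1 : ∀ {A : Set} (f : ℕ → A) k → map f (range 1 (suc k)) ≡ f 1 ∷ map (f ∘ suc) (range 1 k)
map-range-1 f k = cong (f 1 ∷_) (begin
  map f (map suc (applyUpTo suc k))       ≡⟨ cong (map f ∘ map suc) (sym (map-upTo suc k)) ⟩
  map f (map suc (map suc (upTo k)))      ≡⟨ sym (map-∘ (map suc (upTo k))) ⟩
  map (f ∘ suc) (map suc (upTo k))        ∎)

betheList-suc : ∀ d k → betheList d (suc k) ≡ d 1 ∷ betheList (d ∘ suc) k
betheList-suc d k = map-range-1 d k

sumR-suc : ∀ f k → sumR f 1 (suc k) ≡ f 1 + sumR (f ∘ suc) 1 k
sumR-suc f k = cong sum (map-range-1 f k)

nLevel-suc : ∀ d i → nLevel d (suc i) ≡ d 1 * nLevel (d ∘ suc) i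
nLevel-suc d i = cong product (map-range-1 d i)

mSize-suc : ∀ d k i → mSize d (suc k) (suc i) ≡ mSize (d ∘ suc) k i
mSize-suc d k i = cong suc (begin
  sum (map (prodR d (2 + i)) (range (2 + i) (suc k)))          ≡⟨ cong sum (map-range-suc (prodR d (2 + i)) (suc i) k) ⟩
  sum (map (prodR d (2 + i) ∘ suc) (range (suc i) k))          ≡⟨ cong sum (map-cong prodR-suc (range (suc i) k)) ⟩
  sum (map (prodR (d ∘ suc) (suc i)) (range (suc i) k))        ∎)
  where
  prodR-suc : ∀ j → prodR d (2 + i) (suc j) ≡ prodR (d ∘ suc) (suc i) j
  prodR-suc j = cong product (map-range-suc d (suc i) j)

mSize-zero-suc : ∀ d k → mSize d (suc k) 0 ≡ suc (d 1 * mSize (d ∘ suc) k 0)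
mSize-zero-suc d k = cong suc (begin
  sumR (nLevel d) 1 (suc k)                               ≡⟨ sumR-suc (nLevel d) k ⟩
  d 1 * 1 + sum (map (nLevel d ∘ suc) (range 1 k))        ≡⟨ cong (d 1 * 1 +_) (cong sum (map-cong (nLevel-suc d) (range 1 k))) ⟩
  d 1 * 1 + sum (map (λ j → d 1 * nLevel (d ∘ suc) j) (range 1 k))
    ≡⟨ cong (d 1 * 1 +_) (sum-map-*ˡ (d 1) (nLevel (d ∘ suc)) (range 1 k)) ⟩
  d 1 * 1 + d 1 * sumR (nLevel (d ∘ suc)) 1 k             ≡⟨ sym (*-distribˡ-+ (d 1) 1 _) ⟩
  d 1 * mSize (d ∘ suc) k 0                              ∎)

order-betheList : ∀ k d → order (betheList d k) ≡ mSize d k 0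
order-betheList zero    d = refl
order-betheList (suc k) d = begin
  order (betheList d (suc k))                  ≡⟨ cong order (betheList-suc d k) ⟩
  order (d 1 ∷ betheList (d ∘ suc) k)          ≡⟨ order-cons (d 1) (betheList (d ∘ suc) k) ⟩
  suc (d 1 * order (betheList (d ∘ suc) k))    ≡⟨ cong (λ m → suc (d 1 * m)) (order-betheList k (d ∘ suc)) ⟩
  suc (d 1 * mSize (d ∘ suc) k 0)              ≡⟨ sym (mSize-zero-suc d k) ⟩
  mSize d (suc k) 0                            ∎

levelTerm : (ℕ → ℕ) → ℕ → ℕ → ℕ → ℕ
levelTerm d k X i = nLevel d i * mSize d k i * (X ∸ mSize d k i)

levelTerm-suc : ∀ d k X i → levelTerm d (suc k) X (suc i) ≡ d 1 * levelTerm (d ∘ suc) k X i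
levelTerm-suc d k X i = begin
  nLevel d (suc i) * mSize d (suc k) (suc i) * (X ∸ mSize d (suc k) (suc i))
    ≡⟨ cong₂ (λ a m → a * m * (X ∸ m)) (nLevel-suc d i) (mSize-suc d k i) ⟩
  d 1 * nLevel (d ∘ suc) i * m * (X ∸ m)          ≡⟨ cong (_* (X ∸ m)) (*-assoc (d 1) _ m) ⟩
  d 1 * (nLevel (d ∘ suc) i * m) * (X ∸ m)        ≡⟨ *-assoc (d 1) _ (X ∸ m) ⟩
  d 1 * levelTerm (d ∘ suc) k X i                ∎
  where m = mSize (d ∘ suc) k i

sumR-levelTerm≡cutSum : ∀ k d X → sumR (levelTerm d k X) 1 k ≡ cutSum (betheList d k) X
sumR-levelTerm≡cutSum zero    d X = refl
sumR-levelTerm≡cutSum (suc k) d X = begin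
  sumR (levelTerm d (suc k) X) 1 (suc k)
    ≡⟨ sumR-suc (levelTerm d (suc k) X) k ⟩
  d 1 * 1 * mSize d (suc k) 1 * (X ∸ mSize d (suc k) 1) + sum (map (levelTerm d (suc k) X ∘ suc) (range 1 k))
    ≡⟨ cong₂ (λ m s → d 1 * 1 * m * (X ∸ m) + s) top (cong sum (map-cong (levelTerm-suc d k X) (range 1 k))) ⟩
  d 1 * 1 * n * (X ∸ n) + sum (map (λ i → d 1 * levelTerm d′ k X i) (range 1 k))
    ≡⟨ cong₂ (λ a s → a * n * (X ∸ n) + s) (*-identityʳ (d 1)) (sum-map-*ˡ (d 1) (levelTerm d′ k X) (range 1 k)) ⟩
  d 1 * n * (X ∸ n) + d 1 * sumR (levelTerm d′ k X) 1 k
    ≡⟨ cong (λ s → d 1 * n * (X ∸ n) + d 1 * s) (sumR-levelTerm≡cutSum k d′ X) ⟩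
  cutSum (d 1 ∷ betheList d′ k) X
    ≡⟨ cong (λ ds → cutSum ds X) (sym (betheList-suc d k)) ⟩
  cutSum (betheList d (suc k)) X ∎
  where
  d′ = d ∘ suc
  n  = order (betheList d′ k)
  top : mSize d (suc k) 1 ≡ n
  top = trans (mSize-suc d k 0) (sym (order-betheList k d′))

theorem2p3 : (k : ℕ) → 1 ≤ k → (d : ℕ → ℕ) → (∀ i → 1 ≤ i → i ≤ k → 1 ≤ d i) →
    Σ (Vert (betheList d k) → Vert (betheList d k) → ℕ) (IsDistance (betheList d k))
    × ((δ : Vert (betheList d k) → Vert (betheList d k) → ℕ) → IsDistance (betheList d k) δ →
       wiener (betheList d k) δ
         ≡ sumR (λ i → nLevel d i * mSize d k i * (nVerts d k ∸ mSize d k i)) 1 k)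
theorem2p3 k _ d _ = (dist , dist-isDistance ds) , λ δ δ-isDistance → begin
  wiener ds δ                              ≡⟨ pairSum-cong (isDistance⇒≡dist δ-isDistance) (allVerts ds) ⟩
  treeWiener ds                            ≡⟨ treeWiener≡cutSum ds ⟩
  cutSum ds (order ds)                     ≡⟨ sym (sumR-levelTerm≡cutSum k d (order ds)) ⟩
  sumR (levelTerm d k (nVerts d k)) 1 k    ∎
  where ds = betheList d k
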